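{- For integers $1\leq m\leq n$, $$p_{n,m;\leq m;n-m}=m^n-\sum_{i=0}^{m-2}\binom{n}{i}(i+1)^{i-1}(m-i-1)^{n-i}.$$
   Context: Given $m$ parking spaces in a line numbered $1,\dots,m$, $n$ cars arrive in order; car $j$ has preference $a_j$ and parks in the first unoccupied space numbered $\geq a_j$; if there is none, the car cannot park. A preference sequence $(a_1,\dots,a_n)$ is called $k$-flaw if exactly $k$ cars cannot park. $p_{n,m;\leq s;k}$ denotes the number of $k$-flaw preference sequences of length $n$ (with $m$ spaces) with all $a_j\in[s]$. -}

module Defs where

open import Data.Nat using (ℕ; zero; suc; _+_; _*_; _∸_; _^_; _≟_)
open import Data.Bool using (Bool; true; false)
open import Data.List using (List; []; _∷_; [_]; map; concatMap; upTo; length; filter; replicate)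
open import Data.Nat.ListAction using (sum)
open import Data.Maybe using (Maybe; just; nothing)
import Data.Maybe as Maybe
open import Data.Nat.Combinatorics using (_C_)

-- Occupancy of the spaces 1..m as a list of booleans (true = occupied).
-- tryPark a s : a car with preference a (spaces numbered from 1) parks in
-- the first unoccupied space with number ≥ a; nothing if there is none.
tryPark : ℕ → List Bool → Maybe (List Bool)
tryPark a [] = nothing
tryPark (suc (suc a)) (b ∷ bs) = Maybe.map (b ∷_) (tryPark (suc a) bs)
tryPark zero (false ∷ bs) = just (true ∷ bs)
tryPark zero (true ∷ bs) = Maybe.map (true ∷_) (tryPark zero bs)
tryPark (suc zero) (false ∷ bs) = just (true ∷ bs)
tryPark (suc zero) (true ∷ bs) = Maybe.map (true ∷_) (tryPark zero bs)

flaws : List Bool → List ℕ → ℕ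
flaws s [] = 0
flaws s (a ∷ as) with tryPark a s
... | just s' = flaws s' as
... | nothing = suc (flaws s as)

prefSeqs : ℕ → ℕ → List (List ℕ)
prefSeqs zero s = [ [] ]
prefSeqs (suc n) s = concatMap (λ a → map (a ∷_) (prefSeqs n s)) (map suc (upTo s))

p : ℕ → ℕ → ℕ → ℕ → ℕ
p n m s k = length (filter (λ as → flaws (replicate m false) as ≟ k) (prefSeqs n s))

-- Σ_{i=0}^{m-2} C(n,i) (i+1)^{i-1} (m-i-1)^{n-i}   (with 1^{-1} = 1 at i = 0)
rhsSum : ℕ → ℕ → ℕ
rhsSum n m = sum (map (λ i → (n C i) * ((i + 1) ^ (i ∸ 1)) * ((m ∸ i ∸ 1) ^ (n ∸ i))) (upTo (m ∸ 1)))

module Submission where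

-- Let n cars with preferences in [1..m] arrive at m empty spaces.  By the conservation law
-- (flaws + occupied spaces = n) a sequence has exactly n − m flaws iff it leaves the street
-- full.  Otherwise the street has a first empty space i + 1 (0 ≤ i < m), and this happens iff
-- no car prefers space i + 1 and the cars preferring one of the spaces 1..i form a parking
-- function of length i.  The shuffle count turns this into C(n,i)·PF(i)·(m−i−1)^(n−i)
-- sequences, and the term i = m − 1 vanishes.  Pollak's circular argument gives
-- PF(i) = (i+1)^(i−1): on a circle of i + 1 spaces every sequence of i cars leaves exactly one
-- space empty, and turning the circle shows that all spaces are left empty equally often.

open import Defs
open import Data.Nat using (ℕ; zero; suc; _+_; _*_; _∸_; _^_; _≤_; _<_; z≤n; s≤s; z<s; _≡ᵇ_; _≤ᵇ_)
open import Data.Nat.Properties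
open import Data.Nat.Combinatorics using (_C_; nCn≡1; nCk+nC[k+1]≡[n+1]C[k+1])
open import Data.Nat.Combinatorics.Specification using (k>n⇒nCk≡0)
open import Data.Nat.ListAction using (sum)
open import Data.Nat.ListAction.Properties using (sum-↭)
open import Data.Nat.Tactic.RingSolver using (solve-∀)
open import Data.Bool using (Bool; true; false; _∧_; not; if_then_else_; T)
import Data.Bool as Bool
open import Data.Bool.Properties using (∧-zeroʳ)
open import Data.Bool.ListAction using (and; all)
open import Data.List using (List; []; _∷_; [_]; _++_; map; concatMap; upTo; applyUpTo; length; filter; filterᵇ; replicate)
open import Data.List.Properties
  using (length-replicate; length-++; map-∘; map-cong; map-++; ++-assoc; ++-identityʳ; ∷ʳ-injective; ∷ʳ-injectiveʳ;
         ≡-dec; applyUpTo-∷ʳ; filter-accept; filter-reject; filter-all; filter-++)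
open import Data.List.Relation.Unary.All using (All; []; _∷_)
import Data.List.Relation.Unary.All as All
open import Data.List.Relation.Unary.All.Properties using (++⁺) renaming (map⁺ to All-map⁺)
open import Data.List.Relation.Binary.Permutation.Propositional using (_↭_; ↭-sym)
import Data.List.Relation.Binary.Permutation.Propositional.Properties as ↭
open import Data.Product using (_×_; _,_; ∃-syntax)
open import Data.Sum using (inj₁; inj₂)
open import Data.Maybe using (Maybe; just; nothing; fromMaybe)
import Data.Maybe as Maybe
import Data.Maybe.Properties as Maybe
open import Data.Unit using (⊤; tt)
open import Data.Empty using (⊥-elim)
open import Function using (_∘_; id)
open import Relation.Nullary using (does; yes; no)
open import Relation.Nullary.Decidable using (T?; dec-true; dec-false)
open import Relation.Unary using (Decidable)
open import Relation.Binary.PropositionalEquality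
  using (_≡_; _≢_; refl; sym; trans; cong; cong₂; subst; module ≡-Reasoning)
open ≡-Reasoning

private variable A B : Set

bit : Bool → ℕ
bit true  = 1
bit false = 0

true≢false : true ≢ false
true≢false ()

count : (A → Bool) → List A → ℕ
count f []       = 0
count f (x ∷ xs) = bit (f x) + count f xs

sumOver : List A → (A → ℕ) → ℕ
sumOver xs h = sum (map h xs)

syntax sumOver xs (λ x → e) = ∑[ x ∈ xs ] e

sumBelow : ℕ → (ℕ → ℕ) → ℕ
sumBelow zero    f = 0
sumBelow (suc m) f = f 0 + sumBelow m (f ∘ suc)

syntax sumBelow m (λ i → e) = ∑[ i < m ] e

count-++ : (f : A → Bool) (xs ys : List A) → count f (xs ++ ys) ≡ count f xs + count f ys
count-++ f []       ys = refl
count-++ f (x ∷ xs) ys =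
  trans (cong (bit (f x) +_) (count-++ f xs ys)) (sym (+-assoc (bit (f x)) _ _))

count-map : (f : B → Bool) (g : A → B) (xs : List A) → count f (map g xs) ≡ count (f ∘ g) xs
count-map f g []       = refl
count-map f g (x ∷ xs) = cong (bit (f (g x)) +_) (count-map f g xs)

count-cong : {f g : A → Bool} → (∀ x → f x ≡ g x) → (xs : List A) → count f xs ≡ count g xs
count-cong e []       = refl
count-cong e (x ∷ xs) = cong₂ _+_ (cong bit (e x)) (count-cong e xs)

count-congᴬ : {P : A → Set} {f g : A → Bool} {xs : List A} →
  All P xs → (∀ x → P x → f x ≡ g x) → count f xs ≡ count g xs
count-congᴬ []         e = refl
count-congᴬ (px ∷ pxs) e = cong₂ _+_ (cong bit (e _ px)) (count-congᴬ pxs e)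

count-none : {f : A → Bool} → (∀ x → f x ≡ false) → (xs : List A) → count f xs ≡ 0
count-none e []       = refl
count-none {f = f} e (x ∷ xs) = trans (cong (λ b → bit b + count f xs) (e x)) (count-none e xs)

count-true : (xs : List A) → count (λ _ → true) xs ≡ length xs
count-true []       = refl
count-true (x ∷ xs) = cong suc (count-true xs)

count≤length : (f : A → Bool) (xs : List A) → count f xs ≤ length xs
count≤length f []       = z≤n
count≤length f (x ∷ xs) with f x
... | true  = s≤s (count≤length f xs)
... | false = m≤n⇒m≤1+n (count≤length f xs)

length-filter≡count : {P : A → Set} (P? : Decidable P) (xs : List A) →
  length (filter P? xs) ≡ count (does ∘ P?) xs
length-filter≡count P? []       = refl
length-filter≡count P? (x ∷ xs) with does (P? x)
... | true  = cong suc (length-filter≡count P? xs)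
... | false = length-filter≡count P? xs

filterᵇ-all : (p : A → Bool) (xs : List A) → all p xs ≡ true → filterᵇ p xs ≡ xs
filterᵇ-all p []       _   = refl
filterᵇ-all p (x ∷ xs) all-p with p x
... | true = cong (x ∷_) (filterᵇ-all p xs all-p)

count-as-sum : (f : A → Bool) (xs : List A) → count f xs ≡ ∑[ x ∈ xs ] bit (f x)
count-as-sum f []       = refl
count-as-sum f (x ∷ xs) = cong (bit (f x) +_) (count-as-sum f xs)

count-concatMap : (f : B → Bool) (g : A → List B) (xs : List A) →
  count f (concatMap g xs) ≡ ∑[ x ∈ xs ] count f (g x)
count-concatMap f g []       = refl
count-concatMap f g (x ∷ xs) =
  trans (count-++ f (g x) (concatMap g xs)) (cong (count f (g x) +_) (count-concatMap f g xs))

sumOver-cong : {h h′ : A → ℕ} → (∀ x → h x ≡ h′ x) → (xs : List A) → sumOver xs h ≡ sumOver xs h′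
sumOver-cong e xs = cong sum (map-cong e xs)

sumOver-congᴬ : {P : A → Set} {h h′ : A → ℕ} {xs : List A} →
  All P xs → (∀ x → P x → h x ≡ h′ x) → sumOver xs h ≡ sumOver xs h′
sumOver-congᴬ []         e = refl
sumOver-congᴬ (px ∷ pxs) e = cong₂ _+_ (e _ px) (sumOver-congᴬ pxs e)

sumOver-+ : (xs : List A) (h h′ : A → ℕ) → ∑[ x ∈ xs ] (h x + h′ x) ≡ sumOver xs h + sumOver xs h′
sumOver-+ []       h h′ = refl
sumOver-+ (x ∷ xs) h h′ = trans (cong (h x + h′ x +_) (sumOver-+ xs h h′)) (interchange (h x) (h′ x) _ _)
  where
  interchange : ∀ a b c d → a + b + (c + d) ≡ a + c + (b + d)
  interchange = solve-∀

sumOver-const : (xs : List A) (c : ℕ) → ∑[ x ∈ xs ] c ≡ length xs * c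
sumOver-const []       c = refl
sumOver-const (x ∷ xs) c = cong (c +_) (sumOver-const xs c)

sumOver-zero : {h : A → ℕ} → (∀ x → h x ≡ 0) → (xs : List A) → sumOver xs h ≡ 0
sumOver-zero e xs = trans (sumOver-cong e xs) (trans (sumOver-const xs 0) (*-zeroʳ (length xs)))

sumOver-scale : (xs : List A) (h : A → ℕ) (c e : ℕ) → ∑[ x ∈ xs ] (c * h x * e) ≡ c * sumOver xs h * e
sumOver-scale []       h c e = cong (_* e) (sym (*-zeroʳ c))
sumOver-scale (x ∷ xs) h c e = trans (cong (c * h x * e +_) (sumOver-scale xs h c e)) (distrib c (h x) _ e)
  where
  distrib : ∀ c a b e → c * a * e + c * b * e ≡ c * (a + b) * e
  distrib = solve-∀

sumOver-bit : (f : A → Bool) (xs : List A) (v : ℕ) → ∑[ x ∈ xs ] (bit (f x) * v) ≡ count f xs * v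
sumOver-bit f []       v = refl
sumOver-bit f (x ∷ xs) v =
  trans (cong (bit (f x) * v +_) (sumOver-bit f xs v)) (sym (*-distribʳ-+ v (bit (f x)) _))

sumOver-filter : (p : A → Bool) (h : A → ℕ) (xs : List A) →
  ∑[ x ∈ xs ] (if p x then h x else 0) ≡ sumOver (filterᵇ p xs) h
sumOver-filter p h []       = refl
sumOver-filter p h (x ∷ xs) with p x
... | true  = cong (h x +_) (sumOver-filter p h xs)
... | false = sumOver-filter p h xs

sumOver-map : (g : A → B) (h : B → ℕ) (xs : List A) → sumOver (map g xs) h ≡ ∑[ x ∈ xs ] h (g x)
sumOver-map g h xs = cong sum (sym (map-∘ xs))

sumOver-↭ : {xs ys : List A} (h : A → ℕ) → xs ↭ ys → sumOver xs h ≡ sumOver ys h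
sumOver-↭ h p = sum-↭ (↭.map⁺ h p)

sumBelow-cong : ∀ m {f g : ℕ → ℕ} → (∀ i → i < m → f i ≡ g i) → sumBelow m f ≡ sumBelow m g
sumBelow-cong zero    e = refl
sumBelow-cong (suc m) e = cong₂ _+_ (e 0 (s≤s z≤n)) (sumBelow-cong m (λ i i<m → e (suc i) (s≤s i<m)))

sumBelow-+ : ∀ m (f g : ℕ → ℕ) → ∑[ i < m ] (f i + g i) ≡ sumBelow m f + sumBelow m g
sumBelow-+ zero    f g = refl
sumBelow-+ (suc m) f g =
  trans (cong (f 0 + g 0 +_) (sumBelow-+ m (f ∘ suc) (g ∘ suc))) (interchange (f 0) (g 0) _ _)
  where
  interchange : ∀ a b c d → a + b + (c + d) ≡ a + c + (b + d)
  interchange = solve-∀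

sumBelow-const : ∀ m v → ∑[ i < m ] v ≡ m * v
sumBelow-const zero    v = refl
sumBelow-const (suc m) v = cong (v +_) (sumBelow-const m v)

sumBelow-last : ∀ m f → sumBelow (suc m) f ≡ sumBelow m f + f m
sumBelow-last zero    f = +-comm (f 0) 0
sumBelow-last (suc m) f = trans (cong (f 0 +_) (sumBelow-last m (f ∘ suc))) (sym (+-assoc (f 0) _ _))

sumBelow-sumOver : ∀ m (xs : List A) (h : ℕ → A → ℕ) →
  ∑[ i < m ] sumOver xs (h i) ≡ ∑[ x ∈ xs ] ∑[ i < m ] h i x
sumBelow-sumOver m []       h = trans (sumBelow-const m 0) (*-zeroʳ m)
sumBelow-sumOver m (x ∷ xs) h =
  trans (sumBelow-+ m (λ i → h i x) (λ i → sumOver xs (h i))) (cong (sumBelow m (λ i → h i x) +_) (sumBelow-sumOver m xs h))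

sumBelow-count : ∀ m (f : ℕ → A → Bool) (xs : List A) →
  ∑[ i < m ] count (f i) xs ≡ ∑[ x ∈ xs ] ∑[ i < m ] bit (f i x)
sumBelow-count m f xs =
  trans (sumBelow-cong m (λ i _ → count-as-sum (f i) xs)) (sumBelow-sumOver m xs (λ i x → bit (f i x)))

sum-applyUpTo : ∀ (f g : ℕ → ℕ) k → sum (map f (applyUpTo g k)) ≡ ∑[ i < k ] f (g i)
sum-applyUpTo f g zero    = refl
sum-applyUpTo f g (suc k) = cong (f (g 0) +_) (sum-applyUpTo f (g ∘ suc) k)

words : ℕ → List A → List (List A)
words zero    L = [ [] ]
words (suc n) L = concatMap (λ a → map (a ∷_) (words n L)) L

prefSeqs≡words : ∀ n s → prefSeqs n s ≡ words n (map suc (upTo s))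
prefSeqs≡words zero    s = refl
prefSeqs≡words (suc n) s = cong (λ W → concatMap (λ a → map (a ∷_) W) (map suc (upTo s))) (prefSeqs≡words n s)

count-words-suc : (f : List A → Bool) (n : ℕ) (L : List A) →
  count f (words (suc n) L) ≡ ∑[ a ∈ L ] count (λ w → f (a ∷ w)) (words n L)
count-words-suc f n L =
  trans (count-concatMap f (λ a → map (a ∷_) (words n L)) L) (sumOver-cong (λ a → count-map f (a ∷_) (words n L)) L)

All-words : {P : A → Set} (L : List A) → All P L → ∀ n → All (λ w → length w ≡ n × All P w) (words n L)
All-words L pL zero    = (refl , []) ∷ []
All-words {P = P} L pL (suc n) = go L pL
  where
  go : ∀ L′ → All P L′ → All (λ w → length w ≡ suc n × All P w) (concatMap (λ a → map (a ∷_) (words n L)) L′)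
  go []       []          = []
  go (a ∷ L′) (pa ∷ pL′) =
    ++⁺ (All-map⁺ (All.map (λ { (len , pw) → cong suc len , pa ∷ pw }) (All-words L pL n))) (go L′ pL′)

length-words : ∀ n (L : List A) → length (words n L) ≡ length L ^ n
length-words zero    L = refl
length-words (suc n) L = begin
  length (words (suc n) L)                          ≡⟨ sym (count-true (words (suc n) L)) ⟩
  count (λ _ → true) (words (suc n) L)              ≡⟨ count-words-suc (λ _ → true) n L ⟩
  ∑[ a ∈ L ] count (λ _ → true) (words n L)         ≡⟨ sumOver-const L _ ⟩
  length L * count (λ _ → true) (words n L)         ≡⟨ cong (length L *_) (count-true (words n L)) ⟩
  length L * length (words n L)                     ≡⟨ cong (length L *_) (length-words n L) ⟩
  length L * length L ^ n                           ∎

count-words-perm : (τ : A → A) (L : List A) → map τ L ↭ L → ∀ n (f : List A → Bool) →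
  count f (words n L) ≡ count (f ∘ map τ) (words n L)
count-words-perm τ L p zero    f = refl
count-words-perm τ L p (suc n) f = begin
  count f (words (suc n) L)
    ≡⟨ count-words-suc f n L ⟩
  ∑[ a ∈ L ] count (λ w → f (a ∷ w)) (words n L)
    ≡⟨ sumOver-↭ _ (↭-sym p) ⟩
  ∑[ a ∈ map τ L ] count (λ w → f (a ∷ w)) (words n L)
    ≡⟨ sumOver-map τ _ L ⟩
  ∑[ a ∈ L ] count (λ w → f (τ a ∷ w)) (words n L)
    ≡⟨ sumOver-cong (λ a → count-words-perm τ L p n (λ w → f (τ a ∷ w))) L ⟩
  ∑[ a ∈ L ] count (λ w → f (τ a ∷ map τ w)) (words n L)
    ≡⟨ sym (count-words-suc (f ∘ map τ) n L) ⟩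
  count (f ∘ map τ) (words (suc n) L)
    ∎

-- Preference 0 (which never occurs in the paper's sequences) behaves like preference 1.
tryPark-0≡1 : ∀ s → tryPark 0 s ≡ tryPark 1 s
tryPark-0≡1 []          = refl
tryPark-0≡1 (false ∷ s) = refl
tryPark-0≡1 (true ∷ s)  = refl

data Position (i : ℕ) : ℕ → Set where
  within : ∀ {a} → a ≤ i → Position i a
  beyond : ∀ d → Position i (suc (i + d))

position : ∀ i a → Position i a
position i       zero    = within z≤n
position zero    (suc a) = beyond a
position (suc i) (suc a) with position i a
... | within a≤i = within (s≤s a≤i)
... | beyond d   = beyond d

-- What happens on the street s₁ ++ s₂ to a car preferring a space of s₁: it parks in s₁
-- if it can (outcome r on s₁ alone), and otherwise takes the first free space of s₂.
overflow : Maybe (List Bool) → List Bool → List Bool → Maybe (List Bool)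
overflow (just s₁′) s₁ s₂ = just (s₁′ ++ s₂)
overflow nothing    s₁ s₂ = Maybe.map (s₁ ++_) (tryPark 1 s₂)

overflow-∷ : ∀ b r s₁ s₂ → Maybe.map (b ∷_) (overflow r s₁ s₂) ≡ overflow (Maybe.map (b ∷_) r) (b ∷ s₁) s₂
overflow-∷ b (just _) s₁ s₂ = refl
overflow-∷ b nothing  s₁ s₂ = sym (Maybe.map-∘ (tryPark 1 s₂))

tryPark-within : ∀ a s₁ s₂ → a ≤ length s₁ → tryPark a (s₁ ++ s₂) ≡ overflow (tryPark a s₁) s₁ s₂
tryPark-within zero          []           s₂ z≤n = trans (tryPark-0≡1 s₂) (sym (Maybe.map-id (tryPark 1 s₂)))
tryPark-within zero          (false ∷ s₁) s₂ _   = refl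
tryPark-within zero          (true ∷ s₁)  s₂ _   =
  trans (cong (Maybe.map (true ∷_)) (tryPark-within zero s₁ s₂ z≤n)) (overflow-∷ true (tryPark zero s₁) s₁ s₂)
tryPark-within (suc zero)    (false ∷ s₁) s₂ _   = refl
tryPark-within (suc zero)    (true ∷ s₁)  s₂ _   =
  trans (cong (Maybe.map (true ∷_)) (tryPark-within zero s₁ s₂ z≤n)) (overflow-∷ true (tryPark zero s₁) s₁ s₂)
tryPark-within (suc (suc a)) (b ∷ s₁)     s₂ (s≤s a≤) =
  trans (cong (Maybe.map (b ∷_)) (tryPark-within (suc a) s₁ s₂ a≤)) (overflow-∷ b (tryPark (suc a) s₁) s₁ s₂)

tryPark-beyond : ∀ d s₁ s₂ → tryPark (suc (length s₁ + d)) (s₁ ++ s₂) ≡ Maybe.map (s₁ ++_) (tryPark (suc d) s₂)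
tryPark-beyond d []       s₂ = sym (Maybe.map-id (tryPark (suc d) s₂))
tryPark-beyond d (b ∷ s₁) s₂ =
  trans (cong (Maybe.map (b ∷_)) (tryPark-beyond d s₁ s₂)) (sym (Maybe.map-∘ (tryPark (suc d) s₂)))

occupied : List Bool → ℕ
occupied = count (λ b → b)

occupied-empty : ∀ k → occupied (replicate k false) ≡ 0
occupied-empty zero    = refl
occupied-empty (suc k) = occupied-empty k

Parks : List Bool → Maybe (List Bool) → Set
Parks s (just s′) = occupied s′ ≡ suc (occupied s) × length s′ ≡ length s
Parks s nothing   = ⊤

Parks-∷ : ∀ b s r → Parks s r → Parks (b ∷ s) (Maybe.map (b ∷_) r)
Parks-∷ true  s (just _) (occ , len) = cong suc occ , cong suc len
Parks-∷ false s (just _) (occ , len) = occ , cong suc len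
Parks-∷ b     s nothing  tt          = tt

tryPark-parks : ∀ a s → Parks s (tryPark a s)
tryPark-parks a             []          = tt
tryPark-parks zero          (false ∷ s) = refl , refl
tryPark-parks zero          (true ∷ s)  = Parks-∷ true s _ (tryPark-parks zero s)
tryPark-parks (suc zero)    (false ∷ s) = refl , refl
tryPark-parks (suc zero)    (true ∷ s)  = Parks-∷ true s _ (tryPark-parks zero s)
tryPark-parks (suc (suc a)) (b ∷ s)     = Parks-∷ b s _ (tryPark-parks (suc a) s)

park : ℕ → List Bool → List Bool
park a s = fromMaybe s (tryPark a s)

fromMaybe-map-++ : (s₁ s : List Bool) (r : Maybe (List Bool)) →
  fromMaybe (s₁ ++ s) (Maybe.map (s₁ ++_) r) ≡ s₁ ++ fromMaybe s r
fromMaybe-map-++ s₁ s (just _) = refl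
fromMaybe-map-++ s₁ s nothing  = refl

run : List Bool → List ℕ → List Bool
run s []       = s
run s (a ∷ as) = run (park a s) as

length-park : ∀ a s → length (park a s) ≡ length s
length-park a s with tryPark a s | tryPark-parks a s
... | just _  | (_ , len) = len
... | nothing | _         = refl

length-run : ∀ s as → length (run s as) ≡ length s
length-run s []       = refl
length-run s (a ∷ as) = trans (length-run (park a s) as) (length-park a s)

-- Conservation law: every car either occupies one more space or is a flaw.
flaws+occupied : ∀ s as → flaws s as + occupied (run s as) ≡ occupied s + length as
flaws+occupied s []       = sym (+-identityʳ _)
flaws+occupied s (a ∷ as) with tryPark a s | tryPark-parks a s
... | just s′ | (occ , _) = begin
  flaws s′ as + occupied (run s′ as) ≡⟨ flaws+occupied s′ as ⟩
  occupied s′ + length as            ≡⟨ cong (_+ length as) occ ⟩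
  suc (occupied s) + length as       ≡⟨ sym (+-suc (occupied s) _) ⟩
  occupied s + suc (length as)       ∎
... | nothing | _ = trans (cong suc (flaws+occupied s as)) (sym (+-suc (occupied s) _))

full⇒replicate : ∀ b → occupied b ≡ length b → b ≡ replicate (length b) true
full⇒replicate []          _    = refl
full⇒replicate (true ∷ b)  full = cong (true ∷_) (full⇒replicate b (suc-injective full))
full⇒replicate (false ∷ b) full = ⊥-elim (1+n≰n (subst (_≤ length b) full (count≤length (λ b → b) b)))

and⇒full : ∀ b → and b ≡ true → occupied b ≡ length b
and⇒full []         _    = refl
and⇒full (true ∷ b) full = cong suc (and⇒full b full)

full⇒and : ∀ b → occupied b ≡ length b → and b ≡ true
full⇒and b full rewrite full⇒replicate b full = and-replicate (length b)
  where
  and-replicate : ∀ k → and (replicate k true) ≡ true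
  and-replicate zero    = refl
  and-replicate (suc k) = and-replicate k

cannot-park⇒full : ∀ s → tryPark 1 s ≡ nothing → occupied s ≡ length s
cannot-park⇒full []          _    = refl
cannot-park⇒full (true ∷ s)  _ with tryPark 0 s in eq
... | nothing = cong suc (cannot-park⇒full s (trans (sym (tryPark-0≡1 s)) eq))
cannot-park⇒full (false ∷ s) ()

-- firstEmptyAt i s : spaces 1, …, i of s are occupied and space i + 1 is empty.
firstEmptyAt : ℕ → List Bool → Bool
firstEmptyAt i       []      = false
firstEmptyAt zero    (b ∷ s) = not b
firstEmptyAt (suc i) (b ∷ s) = b ∧ firstEmptyAt i s

firstEmptyAt-prefix : ∀ s₁ s₂ → firstEmptyAt (length s₁) (s₁ ++ false ∷ s₂) ≡ and s₁
firstEmptyAt-prefix []           s₂ = refl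
firstEmptyAt-prefix (true ∷ s₁)  s₂ = firstEmptyAt-prefix s₁ s₂
firstEmptyAt-prefix (false ∷ s₁) s₂ = refl

firstEmptyAt-occupied : ∀ s₁ s₂ → firstEmptyAt (length s₁) (s₁ ++ true ∷ s₂) ≡ false
firstEmptyAt-occupied []           s₂ = refl
firstEmptyAt-occupied (true ∷ s₁)  s₂ = firstEmptyAt-occupied s₁ s₂
firstEmptyAt-occupied (false ∷ s₁) s₂ = refl

full-or-firstEmpty : ∀ b → bit (and b) + ∑[ i < length b ] bit (firstEmptyAt i b) ≡ 1
full-or-firstEmpty []          = refl
full-or-firstEmpty (true ∷ b)  = full-or-firstEmpty b
full-or-firstEmpty (false ∷ b) = cong suc (trans (sumBelow-const (length b) 0) (*-zeroʳ (length b)))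

count-full-or-firstEmpty : (g : A → List Bool) (m : ℕ) → (∀ x → length (g x) ≡ m) → (xs : List A) →
  length xs ≡ count (and ∘ g) xs + ∑[ i < m ] count (firstEmptyAt i ∘ g) xs
count-full-or-firstEmpty g m len xs = begin
  length xs                                                                  ≡⟨ sym (*-identityʳ _) ⟩
  length xs * 1                                                              ≡⟨ sym (sumOver-const xs 1) ⟩
  ∑[ x ∈ xs ] 1                                                              ≡⟨ sumOver-cong split xs ⟩
  ∑[ x ∈ xs ] (bit (and (g x)) + ∑[ i < m ] bit (firstEmptyAt i (g x)))      ≡⟨ sumOver-+ xs _ _ ⟩
  ∑[ x ∈ xs ] bit (and (g x)) + ∑[ x ∈ xs ] ∑[ i < m ] bit (firstEmptyAt i (g x))
    ≡⟨ sym (cong₂ _+_ (count-as-sum (and ∘ g) xs) (sumBelow-count m (λ i → firstEmptyAt i ∘ g) xs)) ⟩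
  count (and ∘ g) xs + ∑[ i < m ] count (firstEmptyAt i ∘ g) xs              ∎
  where
  split : ∀ x → 1 ≡ bit (and (g x)) + ∑[ i < m ] bit (firstEmptyAt i (g x))
  split x = subst (λ k → 1 ≡ bit (and (g x)) + ∑[ i < k ] bit (firstEmptyAt i (g x))) (len x)
                  (sym (full-or-firstEmpty (g x)))

park-keeps-head : ∀ a s → ∃[ s′ ] park a (true ∷ s) ≡ true ∷ s′
park-keeps-head zero          s = _ , fromMaybe-map-++ [ true ] s (tryPark zero s)
park-keeps-head (suc zero)    s = _ , fromMaybe-map-++ [ true ] s (tryPark zero s)
park-keeps-head (suc (suc a)) s = _ , fromMaybe-map-++ [ true ] s (tryPark (suc a) s)

park-keeps-occupied : ∀ a s₁ s₂ →
  ∃[ s₁′ ] ∃[ s₂′ ] length s₁′ ≡ length s₁ × park a (s₁ ++ true ∷ s₂) ≡ s₁′ ++ true ∷ s₂′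
park-keeps-occupied a s₁ s₂ with position (length s₁) a
... | beyond d with park-keeps-head (suc d) s₂
...   | s₂′ , head = s₁ , s₂′ , refl , (begin
  fromMaybe _ (tryPark (suc (length s₁ + d)) (s₁ ++ true ∷ s₂))
    ≡⟨ cong (fromMaybe _) (tryPark-beyond d s₁ (true ∷ s₂)) ⟩
  fromMaybe _ (Maybe.map (s₁ ++_) (tryPark (suc d) (true ∷ s₂)))
    ≡⟨ fromMaybe-map-++ s₁ (true ∷ s₂) (tryPark (suc d) (true ∷ s₂)) ⟩
  s₁ ++ park (suc d) (true ∷ s₂)
    ≡⟨ cong (s₁ ++_) head ⟩
  s₁ ++ true ∷ s₂′
    ∎)
park-keeps-occupied a s₁ s₂ | within a≤ with tryPark a s₁ | tryPark-parks a s₁ | tryPark-within a s₁ (true ∷ s₂) a≤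
... | just s₁′ | (_ , len) | split = s₁′ , s₂ , len , cong (fromMaybe _) split
... | nothing  | _         | split with park-keeps-head 1 s₂
...   | s₂′ , head = s₁ , s₂′ , refl ,
        trans (cong (fromMaybe _) split)
              (trans (fromMaybe-map-++ s₁ (true ∷ s₂) (tryPark 1 (true ∷ s₂))) (cong (s₁ ++_) head))

run-keeps-occupied : ∀ as s₁ s₂ → firstEmptyAt (length s₁) (run (s₁ ++ true ∷ s₂) as) ≡ false
run-keeps-occupied []       s₁ s₂ = firstEmptyAt-occupied s₁ s₂
run-keeps-occupied (a ∷ as) s₁ s₂ with park-keeps-occupied a s₁ s₂
... | s₁′ , s₂′ , len , eq rewrite eq | sym len = run-keeps-occupied as s₁′ s₂′

fills : List Bool → List ℕ → Bool
fills s v = (flaws s v ≡ᵇ 0) ∧ and (run s v)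

fills-length : ∀ s v → occupied s ≡ 0 → fills s v ≡ true → length v ≡ length s
fills-length s v empty ok with flaws s v ≡ᵇ 0 in no-flaw | and (run s v) in full | ok
... | true  | true  | _ = begin
  length v                           ≡⟨ cong (_+ length v) (sym empty) ⟩
  occupied s + length v              ≡⟨ sym (flaws+occupied s v) ⟩
  flaws s v + occupied (run s v)
    ≡⟨ cong₂ _+_ (≡ᵇ⇒≡ (flaws s v) 0 (subst T (sym no-flaw) _)) (and⇒full (run s v) full) ⟩
  length (run s v)                   ≡⟨ length-run s v ⟩
  length s                           ∎
... | true  | false | ()
... | false | _     | ()

-- If space |s₁| + 1 is initially empty, it is the first empty space
-- at the end iff no car prefers it and the cars preferring one of the first |s₁| spaces
-- fill s₁ (cars preferring later spaces never affect s₁ or space |s₁| + 1).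
firstEmpty-iff : ∀ as s₁ s₂ →
  firstEmptyAt (length s₁) (run (s₁ ++ false ∷ s₂) as)
    ≡ all (λ a → not (a ≡ᵇ suc (length s₁))) as ∧ fills s₁ (filterᵇ (_≤ᵇ length s₁) as)
firstEmpty-iff []       s₁ s₂ = firstEmptyAt-prefix s₁ s₂
firstEmpty-iff (a ∷ as) s₁ s₂ with position (length s₁) a
... | within a≤
  rewrite dec-false (a ≟ suc (length s₁)) (<⇒≢ (s≤s a≤))
        | filter-accept (T? ∘ (_≤ᵇ length s₁)) {a} {as} (≤⇒≤ᵇ a≤)
        | tryPark-within a s₁ (false ∷ s₂) a≤
  with tryPark a s₁ | tryPark-parks a s₁
...   | just s₁′ | (_ , len) rewrite sym len = firstEmpty-iff as s₁′ s₂
...   | nothing  | _ = trans (run-keeps-occupied as s₁ s₂) (sym (∧-zeroʳ _))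
firstEmpty-iff (a ∷ as) s₁ s₂ | beyond zero
  rewrite dec-true (length s₁ + 0 ≟ length s₁) (+-identityʳ (length s₁)) | tryPark-beyond zero s₁ (false ∷ s₂)
  = run-keeps-occupied as s₁ s₂
firstEmpty-iff (a ∷ as) s₁ s₂ | beyond (suc d)
  rewrite dec-false (length s₁ + suc d ≟ length s₁) (>⇒≢ (m<m+n (length s₁) z<s))
        | filter-reject (T? ∘ (_≤ᵇ length s₁)) {suc (length s₁ + suc d)} {as}
                        (<⇒≱ (s≤s (m≤m+n (length s₁) (suc d))) ∘ ≤ᵇ⇒≤ _ _)
        | tryPark-beyond (suc d) s₁ (false ∷ s₂)
        | fromMaybe-map-++ s₁ (false ∷ s₂) (tryPark (suc (suc d)) (false ∷ s₂))
        | fromMaybe-map-++ [ false ] s₂ (tryPark (suc d) s₂) = firstEmpty-iff as s₁ (park (suc d) s₂)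

-- C(n,k+1)·r^(n−k−1) absorbs a factor r into C(n,k+1)·r^(n−k) (both sides vanish when k ≥ n).
absorb-power : ∀ n k r y → r * ((n C suc k) * y * r ^ (n ∸ suc k)) ≡ (n C suc k) * y * r ^ (n ∸ k)
absorb-power n k r y with k <? n
... | yes k<n rewrite +-∸-assoc 1 k<n = rearrange r (n C suc k) y (r ^ (n ∸ suc k))
  where
  rearrange : ∀ r c y e → r * (c * y * e) ≡ c * y * (r * e)
  rearrange = solve-∀
... | no k≮n rewrite k>n⇒nCk≡0 {n} {suc k} (s≤s (≮⇒≥ k≮n)) = *-zeroʳ r

-- Let A ⇒ Q be tests on the letters of an alphabet L.  A word all of whose
-- letters satisfy Q is determined by the positions of its A-letters, the subword they form, and
-- its other letters, each one of the r letters satisfying Q but not A.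
module Shuffle {X : Set} (A Q : X → Bool) (A⇒Q : ∀ a → A a ≡ true → Q a ≡ true) (L : List X) where

  A-letters : List X
  A-letters = filterᵇ A L

  r : ℕ
  r = count (λ a → not (A a) ∧ Q a) L

  good : (List X → Bool) → List X → Bool
  good S w = all Q w ∧ S (filterᵇ A w)

  first-letter : ∀ n (S : List X → Bool) a →
    count (good S ∘ (a ∷_)) (words n L)
      ≡ (if A a then count (good (S ∘ (a ∷_))) (words n L) else 0)
        + bit (not (A a) ∧ Q a) * count (good S) (words n L)
  first-letter n S a with A a in Aa | Q a in Qa
  ... | true  | true  = sym (+-identityʳ _)
  ... | true  | false with () ← trans (sym (A⇒Q a Aa)) Qa
  ... | false | true  = sym (+-identityʳ _)
  ... | false | false = count-none (λ w → refl) (words n L)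

  words-suc : ∀ n (S : List X → Bool) →
    count (good S) (words (suc n) L)
      ≡ ∑[ a ∈ A-letters ] count (good (S ∘ (a ∷_))) (words n L) + r * count (good S) (words n L)
  words-suc n S = begin
    count (good S) (words (suc n) L)
      ≡⟨ count-words-suc (good S) n L ⟩
    ∑[ a ∈ L ] count (good S ∘ (a ∷_)) (words n L)
      ≡⟨ sumOver-cong (first-letter n S) L ⟩
    ∑[ a ∈ L ] ((if A a then U a else 0) + bit (not (A a) ∧ Q a) * V)
      ≡⟨ sumOver-+ L _ _ ⟩
    ∑[ a ∈ L ] (if A a then U a else 0) + ∑[ a ∈ L ] (bit (not (A a) ∧ Q a) * V)
      ≡⟨ cong₂ _+_ (sumOver-filter A U L) (sumOver-bit _ L V) ⟩
    sumOver A-letters U + r * V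
      ∎
    where
    U : X → ℕ
    U a = count (good (S ∘ (a ∷_))) (words n L)
    V : ℕ
    V = count (good S) (words n L)

  Formula : ℕ → Set
  Formula n = ∀ k (S : List X → Bool) → (∀ v → S v ≡ true → length v ≡ k) →
    count (good S) (words n L) ≡ (n C k) * count S (words k A-letters) * r ^ (n ∸ k)

  -- Induction on n: the empty word, and splitting off the first letter (Pascal's rule for the
  -- positions of the A-subword).
  formula-zero : Formula 0
  formula-zero zero    S _ = unit (bit (S []))
    where
    unit : ∀ x → x + 0 ≡ 1 * (x + 0) * 1
    unit = solve-∀
  formula-zero (suc k) S len with S [] in S[]
  ... | true  with () ← len [] S[]
  ... | false = refl

  formula-suc : ∀ n → Formula n → Formula (suc n)
  formula-suc n ih zero S len = begin
    count (good S) (words (suc n) L)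
      ≡⟨ words-suc n S ⟩
    ∑[ a ∈ A-letters ] count (good (S ∘ (a ∷_))) (words n L) + r * count (good S) (words n L)
      ≡⟨ cong₂ _+_ (sumOver-zero (λ a → count-none (no-first-letter a) (words n L)) A-letters)
                   (cong (r *_) (ih zero S len)) ⟩
    0 + r * ((n C 0) * count S (words 0 A-letters) * r ^ n)
      ≡⟨ rearrange r (count S (words 0 A-letters)) (r ^ n) ⟩
    1 * count S (words 0 A-letters) * (r * r ^ n)
      ∎
    where
    no-first-letter : ∀ a w → good (S ∘ (a ∷_)) w ≡ false
    no-first-letter a w with S (a ∷ filterᵇ A w) in accepted
    ... | true  with () ← len _ accepted
    ... | false = ∧-zeroʳ _
    rearrange : ∀ r x e → 0 + r * (1 * x * e) ≡ 1 * x * (r * e)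
    rearrange = solve-∀
  formula-suc n ih (suc k) S len = begin
    count (good S) (words (suc n) L)
      ≡⟨ words-suc n S ⟩
    ∑[ a ∈ A-letters ] count (good (S ∘ (a ∷_))) (words n L) + r * count (good S) (words n L)
      ≡⟨ cong₂ _+_ (sumOver-cong (λ a → ih k (S ∘ (a ∷_)) (λ v e → suc-injective (len (a ∷ v) e))) A-letters)
                   (cong (r *_) (ih (suc k) S len)) ⟩
    ∑[ a ∈ A-letters ] ((n C k) * count (S ∘ (a ∷_)) (words k A-letters) * r ^ (n ∸ k))
      + r * ((n C suc k) * Y * r ^ (n ∸ suc k))
      ≡⟨ cong₂ _+_ first-letters (absorb-power n k r Y) ⟩
    (n C k) * Y * r ^ (n ∸ k) + (n C suc k) * Y * r ^ (n ∸ k)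
      ≡⟨ distrib (n C k) (n C suc k) Y (r ^ (n ∸ k)) ⟩
    (n C k + n C suc k) * Y * r ^ (n ∸ k)
      ≡⟨ cong (λ c → c * Y * r ^ (n ∸ k)) (nCk+nC[k+1]≡[n+1]C[k+1] n k) ⟩
    (suc n C suc k) * Y * r ^ (n ∸ k)
      ∎
    where
    Y : ℕ
    Y = count S (words (suc k) A-letters)
    first-letters : ∑[ a ∈ A-letters ] ((n C k) * count (S ∘ (a ∷_)) (words k A-letters) * r ^ (n ∸ k))
                  ≡ (n C k) * Y * r ^ (n ∸ k)
    first-letters = trans (sumOver-scale A-letters _ (n C k) (r ^ (n ∸ k)))
                          (cong (λ y → (n C k) * y * r ^ (n ∸ k)) (sym (count-words-suc S k A-letters)))
    distrib : ∀ a b y e → a * y * e + b * y * e ≡ (a + b) * y * e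
    distrib = solve-∀

  shuffle : ∀ n → Formula n
  shuffle zero    = formula-zero
  shuffle (suc n) = formula-suc n (shuffle n)

range : ℕ → List ℕ
range zero    = []
range (suc m) = range m ++ [ suc m ]

range-∷ : ∀ m → range (suc m) ≡ 1 ∷ map suc (range m)
range-∷ zero    = refl
range-∷ (suc m) = begin
  range (suc m) ++ [ suc (suc m) ]            ≡⟨ cong (_++ [ suc (suc m) ]) (range-∷ m) ⟩
  1 ∷ (map suc (range m) ++ [ suc (suc m) ])  ≡⟨ cong (1 ∷_) (sym (map-++ suc (range m) [ suc m ])) ⟩
  1 ∷ map suc (range (suc m))                 ∎

upTo≡range : ∀ m → map suc (upTo m) ≡ range m
upTo≡range zero    = refl
upTo≡range (suc m) = begin
  map suc (upTo (suc m))         ≡⟨ cong (map suc) (sym (applyUpTo-∷ʳ id m)) ⟩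
  map suc (upTo m ++ [ m ])      ≡⟨ map-++ suc (upTo m) [ m ] ⟩
  map suc (upTo m) ++ [ suc m ]  ≡⟨ cong (_++ [ suc m ]) (upTo≡range m) ⟩
  range (suc m)                  ∎

length-range : ∀ m → length (range m) ≡ m
length-range zero    = refl
length-range (suc m) = trans (length-++ (range m)) (trans (+-comm (length (range m)) 1) (cong suc (length-range m)))

Bounded : ℕ → ℕ → Set
Bounded m a = 1 ≤ a × a ≤ m

range-bounded : ∀ m → All (Bounded m) (range m)
range-bounded zero    = []
range-bounded (suc m) =
  ++⁺ (All.map (λ { (1≤a , a≤m) → 1≤a , m≤n⇒m≤1+n a≤m }) (range-bounded m)) ((s≤s z≤n , ≤-refl) ∷ [])

filter-range : ∀ i m → i ≤ m → filterᵇ (_≤ᵇ i) (range m) ≡ range i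
filter-range i m i≤m with m≤n⇒m<n∨m≡n i≤m
... | inj₂ refl = filter-all (T? ∘ (_≤ᵇ i)) (All.map (λ { (_ , a≤i) → ≤⇒≤ᵇ a≤i }) (range-bounded i))
filter-range i (suc m) _ | inj₁ (s≤s i≤m) = begin
  filterᵇ (_≤ᵇ i) (range m ++ [ suc m ])
    ≡⟨ filter-++ (T? ∘ (_≤ᵇ i)) (range m) [ suc m ] ⟩
  filterᵇ (_≤ᵇ i) (range m) ++ filterᵇ (_≤ᵇ i) [ suc m ]
    ≡⟨ cong₂ _++_ (filter-range i m i≤m) (filter-reject (T? ∘ (_≤ᵇ i)) (<⇒≱ (s≤s i≤m) ∘ ≤ᵇ⇒≤ (suc m) i)) ⟩
  range i ++ []
    ≡⟨ ++-identityʳ (range i) ⟩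
  range i
    ∎

count-range-beyond : ∀ j m → count (λ a → not (a ≤ᵇ j)) (range m) ≡ m ∸ j
count-range-beyond j zero    = sym (0∸n≡0 j)
count-range-beyond j (suc m) = begin
  count (λ a → not (a ≤ᵇ j)) (range m ++ [ suc m ])  ≡⟨ count-++ _ (range m) [ suc m ] ⟩
  count (λ a → not (a ≤ᵇ j)) (range m) + (bit (not (suc m ≤ᵇ j)) + 0)
                                                     ≡⟨ cong (_+ (bit (not (suc m ≤ᵇ j)) + 0)) (count-range-beyond j m) ⟩
  m ∸ j + (bit (not (suc m ≤ᵇ j)) + 0)               ≡⟨ last j m ⟩
  suc m ∸ j                                          ∎
  where
  last : ∀ j m → m ∸ j + (bit (not (suc m ≤ᵇ j)) + 0) ≡ suc m ∸ j
  last zero    m       = +-comm m 1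
  last (suc j) zero    = sym (0∸n≡0 j)
  last (suc j) (suc m) = last j m

-- Circular parking: a car finding no free space from its preference on starts again at space 1;
-- runᶜ lets a sequence of cars arrive.
restart : Maybe (List Bool) → List Bool → List Bool
restart (just s′) s = s′
restart nothing   s = park 1 s

parkᶜ : ℕ → List Bool → List Bool
parkᶜ a s = restart (tryPark a s) s

runᶜ : List Bool → List ℕ → List Bool
runᶜ s []      = s
runᶜ s (a ∷ u) = runᶜ (parkᶜ a s) u

rotate : List Bool → List Bool
rotate []      = []
rotate (x ∷ s) = s ++ [ x ]

-- The matching relabelling of preferences on a circle of N spaces.
shift : ℕ → ℕ → ℕ
shift N a = if a ≡ᵇ N then 1 else suc a

parkᶜ-1 : ∀ s → parkᶜ 1 s ≡ park 1 s
parkᶜ-1 s with tryPark 1 s in eq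
... | just _  = refl
... | nothing rewrite eq = refl

tryPark-next : ∀ s₁ s₂ → tryPark (suc (length s₁)) (s₁ ++ s₂) ≡ Maybe.map (s₁ ++_) (tryPark 1 s₂)
tryPark-next s₁ s₂ =
  subst (λ i → tryPark (suc i) (s₁ ++ s₂) ≡ Maybe.map (s₁ ++_) (tryPark 1 s₂)) (+-identityʳ (length s₁))
        (tryPark-beyond 0 s₁ s₂)

park-1-rotate : ∀ s → 1 ≤ length s → park 1 (s ++ [ true ]) ≡ rotate (park 1 (true ∷ s))
park-1-rotate s 1≤ rewrite tryPark-within 1 s [ true ] 1≤ | tryPark-0≡1 s with tryPark 1 s
... | just _  = refl
... | nothing = refl

parkᶜ-rotate : ∀ a s → Bounded (length s) a → parkᶜ a (rotate s) ≡ rotate (parkᶜ (shift (length s) a) s)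
parkᶜ-rotate (suc a) (x ∷ s) (_ , s≤s a≤) with m≤n⇒m<n∨m≡n a≤
... | inj₁ a<n rewrite dec-false (a ≟ length s) (<⇒≢ a<n) | tryPark-within (suc a) s [ x ] a<n with tryPark (suc a) s
...   | just _ = refl
parkᶜ-rotate (suc a) (false ∷ s) _ | inj₁ a<n | nothing = refl
parkᶜ-rotate (suc a) (true ∷ s)  _ | inj₁ a<n | nothing = park-1-rotate s (≤-trans (s≤s z≤n) a<n)
parkᶜ-rotate (suc a) (x ∷ s) _ | inj₂ refl rewrite dec-true (a ≟ a) refl | tryPark-next s [ x ] with x | s
... | false | _      = refl
... | true  | []     = refl
... | true  | y ∷ ys = trans (park-1-rotate (y ∷ ys) (s≤s z≤n)) (cong rotate (sym (parkᶜ-1 (true ∷ y ∷ ys))))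

length-parkᶜ : ∀ a s → length (parkᶜ a s) ≡ length s
length-parkᶜ a s with tryPark a s | tryPark-parks a s
... | just _  | (_ , len) = len
... | nothing | _         = length-park 1 s

runᶜ-rotate : ∀ N s u → length s ≡ N → All (Bounded N) u → runᶜ (rotate s) u ≡ rotate (runᶜ s (map (shift N) u))
runᶜ-rotate N s []      _    _          = refl
runᶜ-rotate N s (a ∷ u) refl (a∈ ∷ u∈) =
  trans (cong (λ t → runᶜ t u) (parkᶜ-rotate a s a∈)) (runᶜ-rotate N (parkᶜ (shift N a) s) u (length-parkᶜ _ s) u∈)

parkᶜ-occupies : ∀ a s → occupied s < length s → occupied (parkᶜ a s) ≡ suc (occupied s)
parkᶜ-occupies a s not-full with tryPark a s | tryPark-parks a s
... | just _  | (occ , _) = occ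
... | nothing | _ with tryPark 1 s in fails | tryPark-parks 1 s
...   | just _  | (occ , _) = occ
...   | nothing | _         = ⊥-elim (<-irrefl (cannot-park⇒full s fails) not-full)

runᶜ-occupies : ∀ u s → occupied s + length u ≤ length s → occupied (runᶜ s u) ≡ occupied s + length u
runᶜ-occupies []      s _    = sym (+-identityʳ _)
runᶜ-occupies (a ∷ u) s room = begin
  occupied (runᶜ (parkᶜ a s) u)      ≡⟨ runᶜ-occupies u (parkᶜ a s) room′ ⟩
  occupied (parkᶜ a s) + length u    ≡⟨ cong (_+ length u) occ ⟩
  suc (occupied s) + length u        ≡⟨ sym (+-suc (occupied s) (length u)) ⟩
  occupied s + suc (length u)        ∎
  where
  room″ : suc (occupied s) + length u ≤ length s
  room″ = subst (_≤ length s) (+-suc (occupied s) (length u)) room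
  occ : occupied (parkᶜ a s) ≡ suc (occupied s)
  occ = parkᶜ-occupies a s (≤-trans (m≤m+n (suc (occupied s)) (length u)) room″)
  room′ : occupied (parkᶜ a s) + length u ≤ length (parkᶜ a s)
  room′ rewrite occ | length-parkᶜ a s = room″

shift-below : ∀ n as → All (Bounded n) as → map (shift (suc n)) as ≡ map suc as
shift-below n []       []                 = refl
shift-below n (a ∷ as) ((_ , a≤n) ∷ as∈) rewrite dec-false (a ≟ suc n) (<⇒≢ (s≤s a≤n)) =
  cong (suc a ∷_) (shift-below n as as∈)

shift-range : ∀ n → map (shift (suc n)) (range (suc n)) ↭ range (suc n)
shift-range n rewrite map-++ (shift (suc n)) (range n) [ suc n ] | shift-below n (range n) (range-bounded n)
                    | dec-true (n ≟ n) refl | range-∷ n = ↭.++-comm (map suc (range n)) [ 1 ]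

rotate-injective : ∀ s t → rotate s ≡ rotate t → s ≡ t
rotate-injective []          []          _  = refl
rotate-injective []          (_ ∷ [])    ()
rotate-injective []          (_ ∷ _ ∷ _) ()
rotate-injective (_ ∷ [])    []          ()
rotate-injective (_ ∷ _ ∷ _) []          ()
rotate-injective (x ∷ s)     (y ∷ t)     eq with ∷ʳ-injective s t eq
... | s≡t , x≡y = cong₂ _∷_ x≡y s≡t

infix 4 _==ˢ_
_==ˢ_ : List Bool → List Bool → Bool
s ==ˢ t = does (≡-dec Bool._≟_ s t)

==ˢ-rotate : ∀ s t → (rotate s ==ˢ rotate t) ≡ (s ==ˢ t)
==ˢ-rotate s t with ≡-dec Bool._≟_ s t
... | yes refl = dec-true (≡-dec Bool._≟_ (rotate s) (rotate s)) refl
... | no  s≢t  = dec-false (≡-dec Bool._≟_ (rotate s) (rotate t)) (s≢t ∘ rotate-injective s t)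

replicate-∷ʳ : ∀ k (b : Bool) → replicate k b ++ [ b ] ≡ b ∷ replicate k b
replicate-∷ʳ zero    b = refl
replicate-∷ʳ (suc k) b = cong (b ∷_) (replicate-∷ʳ k b)

onlyEmpty : ℕ → ℕ → List Bool
onlyEmpty n c = replicate c true ++ false ∷ replicate (n ∸ c) true

rotate-onlyEmpty : ∀ n c → c < n → rotate (onlyEmpty n (suc c)) ≡ onlyEmpty n c
rotate-onlyEmpty n c c<n = begin
  (replicate c true ++ false ∷ replicate (n ∸ suc c) true) ++ [ true ]
    ≡⟨ ++-assoc (replicate c true) _ _ ⟩
  replicate c true ++ false ∷ (replicate (n ∸ suc c) true ++ [ true ])
    ≡⟨ cong (λ t → replicate c true ++ false ∷ t) (replicate-∷ʳ (n ∸ suc c) true) ⟩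
  replicate c true ++ false ∷ replicate (suc (n ∸ suc c)) true
    ≡⟨ cong (λ k → replicate c true ++ false ∷ replicate k true) (sym (+-∸-assoc 1 c<n)) ⟩
  replicate c true ++ false ∷ replicate (n ∸ c) true
    ∎

exactly-one-empty : ∀ n b → length b ≡ suc n → occupied b ≡ n → ∑[ c < suc n ] bit (b ==ˢ onlyEmpty n c) ≡ 1
exactly-one-empty zero    (false ∷ []) _   _   = refl
exactly-one-empty (suc n) (true ∷ b)   len occ = exactly-one-empty n b (suc-injective len) (suc-injective occ)
exactly-one-empty (suc n) (false ∷ b)  len occ
  rewrite full⇒replicate b (trans occ (sym (suc-injective len))) | suc-injective len
        | dec-true (≡-dec Bool._≟_ (replicate (suc n) true) (replicate (suc n) true)) refl
  = cong suc (trans (sumBelow-const (suc n) 0) (*-zeroʳ (suc n)))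

park-1-keeps-last : ∀ s → ∃[ t ] park 1 (s ++ [ true ]) ≡ t ++ [ true ]
park-1-keeps-last []      = [] , refl
park-1-keeps-last (b ∷ s) rewrite tryPark-within 1 (b ∷ s) [ true ] (s≤s z≤n) with tryPark 1 (b ∷ s)
... | just t  = t , refl
... | nothing = b ∷ s , refl

parkᶜ-keeps-last : ∀ a s → ∃[ t ] parkᶜ a (s ++ [ true ]) ≡ t ++ [ true ]
parkᶜ-keeps-last a s with position (length s) a
... | beyond d rewrite tryPark-beyond d s [ true ] with d
...   | zero  = park-1-keeps-last s
...   | suc _ = park-1-keeps-last s
parkᶜ-keeps-last a s | within a≤ rewrite tryPark-within a s [ true ] a≤ with tryPark a s
... | just t  = t , refl
... | nothing = park-1-keeps-last s

runᶜ-keeps-last : ∀ u s → ∃[ t ] runᶜ (s ++ [ true ]) u ≡ t ++ [ true ]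
runᶜ-keeps-last []      s = s , refl
runᶜ-keeps-last (a ∷ u) s with parkᶜ-keeps-last a s
... | t , eq rewrite eq = runᶜ-keeps-last u t

runᶜ-last-taken : ∀ u s → (runᶜ (s ++ [ true ]) u ==ˢ replicate (length s) true ++ [ false ]) ≡ false
runᶜ-last-taken u s with runᶜ-keeps-last u s
... | t , eq rewrite eq =
  dec-false (≡-dec Bool._≟_ _ _) (λ eq′ → true≢false (∷ʳ-injectiveʳ t (replicate (length s) true) eq′))

last-empty-pattern : ∀ s → (s ++ [ false ] ==ˢ replicate (length s) true ++ [ false ]) ≡ and s
last-empty-pattern []          = refl
last-empty-pattern (true ∷ s)  = last-empty-pattern s
last-empty-pattern (false ∷ s) = refl

circular-last-empty : ∀ u s → All (Bounded (suc (length s))) u →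
  (runᶜ (s ++ [ false ]) u ==ˢ replicate (length s) true ++ [ false ]) ≡ all (_≤ᵇ length s) u ∧ fills s u
circular-last-empty []      s _ = last-empty-pattern s
circular-last-empty (a ∷ u) s ((_ , a≤) ∷ u∈) with position (length s) a
... | within a≤s rewrite dec-true (a ≤? length s) a≤s | tryPark-within a s [ false ] a≤s
  with tryPark a s | tryPark-parks a s
...   | just s′ | (_ , len) rewrite sym len = circular-last-empty u s′ u∈
...   | nothing | _ = trans (runᶜ-last-taken u s) (sym (∧-zeroʳ _))
circular-last-empty (a ∷ u) s ((_ , a≤) ∷ u∈) | beyond zero
  rewrite dec-false (a ≤? length s) (<⇒≱ (s≤s (m≤m+n (length s) 0))) | tryPark-beyond 0 s [ false ]
  = runᶜ-last-taken u s
circular-last-empty (a ∷ u) s ((_ , a≤) ∷ u∈) | beyond (suc d) =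
  ⊥-elim (<⇒≱ (s≤s (m<m+n (length s) z<s)) a≤)

circular-last-empty′ : ∀ k u s → length s ≡ k → All (Bounded (suc k)) u →
  (runᶜ (s ++ [ false ]) u ==ˢ replicate k true ++ [ false ]) ≡ all (_≤ᵇ k) u ∧ fills s u
circular-last-empty′ _ u s refl u∈ = circular-last-empty u s u∈

length-runᶜ : ∀ s u → length (runᶜ s u) ≡ length s
length-runᶜ s []      = refl
length-runᶜ s (a ∷ u) = trans (length-runᶜ (parkᶜ a s) u) (length-parkᶜ a s)

-- On a circle of n + 1 spaces each of the (n+1)^n sequences of n
-- cars leaves exactly one space empty, and turning the circle shows that every space is left
-- empty equally often; so the last space is left empty (n+1)^(n−1) times.
module Pollak (n : ℕ) where

  prefs : List ℕ
  prefs = range (suc n)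

  circle : List Bool
  circle = replicate (suc n) false

  leavesOnly : ℕ → List ℕ → Bool
  leavesOnly c u = runᶜ circle u ==ˢ onlyEmpty n c

  E : ℕ → ℕ
  E c = count (leavesOnly c) (words n prefs)

  prefs-words : All (λ u → length u ≡ n × All (Bounded (suc n)) u) (words n prefs)
  prefs-words = All-words prefs (range-bounded (suc n)) n

  -- Relabelling the preferences turns the circle.
  E-rotate : ∀ c → E c ≡ count (λ u → runᶜ circle u ==ˢ rotate (onlyEmpty n c)) (words n prefs)
  E-rotate c = trans (count-words-perm (shift (suc n)) prefs (shift-range n) n (leavesOnly c))
                     (count-congᴬ prefs-words (λ u (_ , u∈) → relabel u u∈))
    where
    relabel : ∀ u → All (Bounded (suc n)) u →
      leavesOnly c (map (shift (suc n)) u) ≡ (runᶜ circle u ==ˢ rotate (onlyEmpty n c))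
    relabel u u∈ = begin
      runᶜ circle (map (shift (suc n)) u) ==ˢ onlyEmpty n c
        ≡⟨ sym (==ˢ-rotate (runᶜ circle (map (shift (suc n)) u)) (onlyEmpty n c)) ⟩
      rotate (runᶜ circle (map (shift (suc n)) u)) ==ˢ rotate (onlyEmpty n c)
        ≡⟨ cong (_==ˢ rotate (onlyEmpty n c)) (sym (runᶜ-rotate (suc n) circle u (length-replicate (suc n)) u∈)) ⟩
      runᶜ (rotate circle) u ==ˢ rotate (onlyEmpty n c)
        ≡⟨ cong (λ s → runᶜ s u ==ˢ rotate (onlyEmpty n c)) (replicate-∷ʳ n false) ⟩
      runᶜ circle u ==ˢ rotate (onlyEmpty n c)
        ∎

  E-step : ∀ c → c < n → E (suc c) ≡ E c
  E-step c c<n = trans (E-rotate (suc c))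
    (cong (λ t → count (λ u → runᶜ circle u ==ˢ t) (words n prefs)) (rotate-onlyEmpty n c c<n))

  E-equal : ∀ d c → c + d ≡ n → E c ≡ E n
  E-equal zero    c c+0≡n = cong E (trans (sym (+-identityʳ c)) c+0≡n)
  E-equal (suc d) c c+d≡n = trans (sym (E-step c c<n)) (E-equal d (suc c) (trans (sym (+-suc c d)) c+d≡n))
    where
    c<n : c < n
    c<n = subst (c <_) c+d≡n (m<m+n c z<s)

  E-total : ∑[ c < suc n ] E c ≡ suc n ^ n
  E-total = begin
    ∑[ c < suc n ] E c
      ≡⟨ sumBelow-count (suc n) leavesOnly (words n prefs) ⟩
    ∑[ u ∈ words n prefs ] ∑[ c < suc n ] bit (leavesOnly c u)
      ≡⟨ sumOver-congᴬ prefs-words (λ u (len , _) → one-empty u len) ⟩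
    ∑[ u ∈ words n prefs ] 1
      ≡⟨ sumOver-const (words n prefs) 1 ⟩
    length (words n prefs) * 1
      ≡⟨ *-identityʳ _ ⟩
    length (words n prefs)
      ≡⟨ length-words n prefs ⟩
    length prefs ^ n
      ≡⟨ cong (_^ n) (length-range (suc n)) ⟩
    suc n ^ n
      ∎
    where
    one-empty : ∀ u → length u ≡ n → ∑[ c < suc n ] bit (leavesOnly c u) ≡ 1
    one-empty u len = exactly-one-empty n (runᶜ circle u)
      (trans (length-runᶜ circle u) (length-replicate (suc n)))
      (trans (runᶜ-occupies u circle room) (trans (cong (_+ length u) (occupied-empty (suc n))) len))
      where
      room : occupied circle + length u ≤ length circle
      room rewrite occupied-empty (suc n) | len | length-replicate (suc n) {false} = n≤1+n n

  E-last : E n ≡ suc n ^ (n ∸ 1)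
  E-last = cancel n (E n) scaled
    where
    scaled : suc n * E n ≡ suc n ^ n
    scaled = begin
      suc n * E n         ≡⟨ sym (sumBelow-const (suc n) (E n)) ⟩
      ∑[ c < suc n ] E n  ≡⟨ sumBelow-cong (suc n) (λ c c≤n → sym (E-equal (n ∸ c) c (m+[n∸m]≡n (≤-pred c≤n)))) ⟩
      ∑[ c < suc n ] E c  ≡⟨ E-total ⟩
      suc n ^ n           ∎
    cancel : ∀ k x → suc k * x ≡ suc k ^ k → x ≡ suc k ^ (k ∸ 1)
    cancel zero    x eq = trans (sym (+-identityʳ x)) eq
    cancel (suc k) x eq = *-cancelˡ-≡ x (suc (suc k) ^ k) (suc (suc k)) eq

  E-last-linear : E n ≡ count (λ u → all (_≤ᵇ n) u ∧ fills (replicate n false) u) (words n prefs)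
  E-last-linear = count-congᴬ prefs-words (λ u (_ , u∈) → last-linear u u∈)
    where
    last-linear : ∀ u → All (Bounded (suc n)) u → leavesOnly n u ≡ (all (_≤ᵇ n) u ∧ fills (replicate n false) u)
    last-linear u u∈ = begin
      runᶜ circle u ==ˢ onlyEmpty n n
        ≡⟨ cong₂ (λ s t → runᶜ s u ==ˢ replicate n true ++ false ∷ replicate t true)
                 (sym (replicate-∷ʳ n false)) (n∸n≡0 n) ⟩
      runᶜ (replicate n false ++ [ false ]) u ==ˢ replicate n true ++ [ false ]
        ≡⟨ circular-last-empty′ n u (replicate n false) (length-replicate n) u∈ ⟩
      all (_≤ᵇ n) u ∧ fills (replicate n false) u
        ∎

parkingFunctions : ℕ → ℕ
parkingFunctions i = count (fills (replicate i false)) (words i (range i))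

pollak : ∀ n → parkingFunctions n ≡ suc n ^ (n ∸ 1)
pollak n = begin
  parkingFunctions n                               ≡⟨ sym restrict ⟩
  count (good S) (words n prefs)                   ≡⟨ count-cong drop-filter (words n prefs) ⟩
  count (λ u → all (_≤ᵇ n) u ∧ S u) (words n prefs) ≡⟨ sym E-last-linear ⟩
  E n                                              ≡⟨ E-last ⟩
  suc n ^ (n ∸ 1)                                  ∎
  where
  open Pollak n
  S : List ℕ → Bool
  S = fills (replicate n false)
  -- Words over [1..n+1] avoiding n + 1 are the words over [1..n]: the shuffle count with
  -- k = n, where C(n,n) = 1, r^0 = 1 and the letters ≤ n of [1..n+1] form [1..n].
  open Shuffle (_≤ᵇ n) (_≤ᵇ n) (λ _ a≤n → a≤n) prefs
  restrict : count (good S) (words n prefs) ≡ parkingFunctions n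
  restrict rewrite shuffle n n S (λ v ok → trans (fills-length _ v (occupied-empty n) ok) (length-replicate n))
                 | nCn≡1 n | n∸n≡0 n | filter-range n (suc n) (n≤1+n n) = trans (*-identityʳ _) (+-identityʳ _)
  drop-filter : ∀ u → good S u ≡ (all (_≤ᵇ n) u ∧ S u)
  drop-filter u with all (_≤ᵇ n) u in all≤n
  ... | true  = cong S (filterᵇ-all (_≤ᵇ n) u all≤n)
  ... | false = refl

replicate-split : ∀ (b : Bool) i m → i < m → replicate m b ≡ replicate i b ++ b ∷ replicate (m ∸ suc i) b
replicate-split b zero    (suc m) _         = refl
replicate-split b (suc i) (suc m) (s≤s i<m) = cong (b ∷_) (replicate-split b i m i<m)

firstEmpty-of-empty : ∀ i m w → i < m →
  firstEmptyAt i (run (replicate m false) w)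
    ≡ all (λ a → not (a ≡ᵇ suc i)) w ∧ fills (replicate i false) (filterᵇ (_≤ᵇ i) w)
firstEmpty-of-empty i m w i<m rewrite replicate-split false i m i<m = at i (length-replicate i)
  where
  at : ∀ k → length (replicate i false) ≡ k →
    firstEmptyAt k (run (replicate i false ++ false ∷ replicate (m ∸ suc i) false) w)
      ≡ all (λ a → not (a ≡ᵇ suc k)) w ∧ fills (replicate i false) (filterᵇ (_≤ᵇ k) w)
  at _ refl = firstEmpty-iff w (replicate i false) (replicate (m ∸ suc i) false)

beyond-next : ∀ i a → not (a ≤ᵇ i) ∧ not (a ≡ᵇ suc i) ≡ not (a ≤ᵇ suc i)
beyond-next i       zero          = refl
beyond-next zero    (suc zero)    = refl
beyond-next zero    (suc (suc a)) = refl
beyond-next (suc i) (suc zero)    = refl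
beyond-next (suc i) (suc (suc a)) = beyond-next i (suc a)

-- The sequences in [1..m]^n whose first empty space is i + 1: choose the positions of the
-- cars preferring spaces ≤ i, a parking function for them, and a preference beyond i + 1
-- for each other car.
count-firstEmpty : ∀ n m i → i < m →
  count (firstEmptyAt i ∘ run (replicate m false)) (words n (range m))
    ≡ (n C i) * parkingFunctions i * (m ∸ suc i) ^ (n ∸ i)
count-firstEmpty n m i i<m = begin
  count (firstEmptyAt i ∘ run (replicate m false)) (words n (range m))
    ≡⟨ count-cong (λ w → firstEmpty-of-empty i m w i<m) (words n (range m)) ⟩
  count (good S) (words n (range m))
    ≡⟨ shuffle n i S (λ v ok → trans (fills-length _ v (occupied-empty i) ok) (length-replicate i)) ⟩
  (n C i) * count S (words i A-letters) * r ^ (n ∸ i)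
    ≡⟨ cong₂ (λ L k → (n C i) * count S (words i L) * k ^ (n ∸ i)) (filter-range i m (<⇒≤ i<m)) others ⟩
  (n C i) * parkingFunctions i * (m ∸ suc i) ^ (n ∸ i)
    ∎
  where
  S : List ℕ → Bool
  S = fills (replicate i false)
  A⇒Q : ∀ a → (a ≤ᵇ i) ≡ true → not (a ≡ᵇ suc i) ≡ true
  A⇒Q a a≤i = cong not (dec-false (a ≟ suc i) (<⇒≢ (s≤s (≤ᵇ⇒≤ a i (subst T (sym a≤i) _)))))
  open Shuffle (_≤ᵇ i) (λ a → not (a ≡ᵇ suc i)) A⇒Q (range m)
  others : r ≡ m ∸ suc i
  others = trans (count-cong (beyond-next i) (range m)) (count-range-beyond (suc i) m)

-- By the conservation law, n cars on m ≤ n empty spaces have exactly n − m flaws iff they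
-- fill all the spaces.
n∸m-flaws⇔full : ∀ n m w → m ≤ n → length w ≡ n →
  (flaws (replicate m false) w ≡ᵇ n ∸ m) ≡ and (run (replicate m false) w)
n∸m-flaws⇔full n m w m≤n len = by-fullness (and final) refl
  where
  e final : List Bool
  e     = replicate m false
  final = run e w
  length-final : length final ≡ m
  length-final = trans (length-run e w) (length-replicate m)
  balance : flaws e w + occupied final ≡ n
  balance = trans (flaws+occupied e w) (trans (cong (_+ length w) (occupied-empty m)) len)
  full⇒n∸m : occupied final ≡ m → flaws e w ≡ n ∸ m
  full⇒n∸m o≡m = trans (sym (m+n∸n≡m (flaws e w) (occupied final))) (cong₂ _∸_ balance o≡m)
  n∸m⇒full : flaws e w ≡ n ∸ m → occupied final ≡ m
  n∸m⇒full f≡ = +-cancelˡ-≡ (n ∸ m) (occupied final) m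
    (trans (cong (_+ occupied final) (sym f≡)) (trans balance (sym (m∸n+n≡m m≤n))))
  by-fullness : ∀ b → and final ≡ b → (flaws e w ≡ᵇ n ∸ m) ≡ b
  by-fullness true  full     = dec-true (flaws e w ≟ n ∸ m) (full⇒n∸m (trans (and⇒full final full) length-final))
  by-fullness false not-full = dec-false (flaws e w ≟ n ∸ m) λ f≡ →
    true≢false (trans (sym (full⇒and final (trans (n∸m⇒full f≡) (sym length-final)))) not-full)

-- The i-th term of the paper's sum, with the number of parking functions in place of (i+1)^(i−1):
-- the number of sequences in [1..m]^n whose first empty space is i + 1.
firstEmptyTerm : ℕ → ℕ → ℕ → ℕ
firstEmptyTerm n m i = (n C i) * parkingFunctions i * (m ∸ suc i) ^ (n ∸ i)

p≡count-full : ∀ n m → m ≤ n → p n m m (n ∸ m) ≡ count (and ∘ run (replicate m false)) (words n (range m))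
p≡count-full n m m≤n = begin
  p n m m (n ∸ m)
    ≡⟨ length-filter≡count (λ as → flaws e as ≟ n ∸ m) (prefSeqs n m) ⟩
  count (λ as → flaws e as ≡ᵇ n ∸ m) (prefSeqs n m)
    ≡⟨ cong (count (λ as → flaws e as ≡ᵇ n ∸ m)) (trans (prefSeqs≡words n m) (cong (words n) (upTo≡range m))) ⟩
  count (λ as → flaws e as ≡ᵇ n ∸ m) (words n (range m))
    ≡⟨ count-congᴬ (All-words (range m) (range-bounded m) n) (λ w (len , _) → n∸m-flaws⇔full n m w m≤n len) ⟩
  count (and ∘ run e) (words n (range m))
    ∎
  where
  e : List Bool
  e = replicate m false

classify : ∀ n m → m ≤ n → m ^ n ≡ p n m m (n ∸ m) + ∑[ i < m ] firstEmptyTerm n m i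
classify n m m≤n = begin
  m ^ n
    ≡⟨ sym (trans (length-words n (range m)) (cong (_^ n) (length-range m))) ⟩
  length W
    ≡⟨ count-full-or-firstEmpty (run e) m (λ w → trans (length-run e w) (length-replicate m)) W ⟩
  count (and ∘ run e) W + ∑[ i < m ] count (firstEmptyAt i ∘ run e) W
    ≡⟨ cong₂ _+_ (sym (p≡count-full n m m≤n)) (sumBelow-cong m (count-firstEmpty n m)) ⟩
  p n m m (n ∸ m) + ∑[ i < m ] firstEmptyTerm n m i
    ∎
  where
  e : List Bool
  e = replicate m false
  W : List (List ℕ)
  W = words n (range m)

-- The paper's sum: by Pollak's formula its terms are the firstEmptyTerm's, except the
-- vanishing last one (i = m − 1).
rhsSum≡ : ∀ n m → 1 ≤ m → m ≤ n → rhsSum n m ≡ ∑[ i < m ] firstEmptyTerm n m i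
rhsSum≡ n (suc m) _ m<n = begin
  rhsSum n (suc m)
    ≡⟨ sum-applyUpTo _ id m ⟩
  ∑[ i < m ] ((n C i) * (i + 1) ^ (i ∸ 1) * (suc m ∸ i ∸ 1) ^ (n ∸ i))
    ≡⟨ sumBelow-cong m (λ i _ → paper-term i) ⟩
  ∑[ i < m ] firstEmptyTerm n (suc m) i
    ≡⟨ sym (+-identityʳ _) ⟩
  ∑[ i < m ] firstEmptyTerm n (suc m) i + 0
    ≡⟨ cong (sumBelow m (firstEmptyTerm n (suc m)) +_) (sym last-vanishes) ⟩
  ∑[ i < m ] firstEmptyTerm n (suc m) i + firstEmptyTerm n (suc m) m
    ≡⟨ sym (sumBelow-last m (firstEmptyTerm n (suc m))) ⟩
  ∑[ i < suc m ] firstEmptyTerm n (suc m) i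
    ∎
  where
  paper-term : ∀ i → (n C i) * (i + 1) ^ (i ∸ 1) * (suc m ∸ i ∸ 1) ^ (n ∸ i) ≡ firstEmptyTerm n (suc m) i
  paper-term i rewrite pollak i | +-comm i 1 | ∸-+-assoc (suc m) i 1 | +-comm i 1 = refl
  last-vanishes : firstEmptyTerm n (suc m) m ≡ 0
  last-vanishes = trans (cong₂ (λ b k → (n C m) * parkingFunctions m * b ^ k) (n∸n≡0 m) (+-∸-assoc 1 m<n))
                        (*-zeroʳ ((n C m) * parkingFunctions m))

open import Data.Integer using (+_; _-_; _⊖_)
open import Data.Integer.Properties using (m-n≡m⊖n; ⊖-≥)

lemma2p4 : (n m : ℕ) → 1 ≤ m → m ≤ n →
    + (p n m m (n ∸ m)) ≡ + (m ^ n) - + (rhsSum n m)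
lemma2p4 n m 1≤m m≤n = begin
  + p n m m (n ∸ m)                            ≡⟨ cong +_ (sym (m+n∸n≡m (p n m m (n ∸ m)) (rhsSum n m))) ⟩
  + (p n m m (n ∸ m) + rhsSum n m ∸ rhsSum n m) ≡⟨ cong (λ k → + (k ∸ rhsSum n m)) (sym total) ⟩
  + (m ^ n ∸ rhsSum n m)                       ≡⟨ sym (⊖-≥ (subst (rhsSum n m ≤_) (sym total) (m≤n+m _ _))) ⟩
  m ^ n ⊖ rhsSum n m                           ≡⟨ sym (m-n≡m⊖n (m ^ n) (rhsSum n m)) ⟩
  + (m ^ n) - + (rhsSum n m)                   ∎
  where
  total : m ^ n ≡ p n m m (n ∸ m) + rhsSum n m
  total = trans (classify n m m≤n) (cong (λ k → p n m m (n ∸ m) + k) (sym (rhsSum≡ n m 1≤m m≤n)))
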